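{- Let $G\in\mathcal{U}(N,k)$ and let $u$ be a vertex on the cycle of $G$. Suppose that two pendant paths $P_2: u=v_0\sim v_1\sim v_2$ (of length $2$) and $P_m: u=u_0\sim u_1\sim\cdots\sim u_m$ of length $m\ge 2$ are attached at $u$. Let $G^*$ be the graph obtained from $G$ by deleting the edge $v_2v_1$ and adding the edge $u_mv_2$. Then $SO(G^*)>SO(G)$.
   Context: All graphs are finite, simple and connected. For a graph $G$ with vertex degrees $d(\cdot)$, the Sombor index is $SO(G)=\sum_{xy\in E(G)}\sqrt{d(x)^2+d(y)^2}$. A pendant vertex is a vertex of degree $1$. $\mathcal{U}(N,k)$ is the class of connected unicyclic graphs (exactly one cycle) on $N$ vertices with exactly $k$ pendant vertices. A pendant path of length $\ell$ attached at a cycle vertex $c$ is a path $c=p_0\sim p_1\sim\cdots\sim p_\ell$ with $p_1,\dots,p_\ell$ not on the cycle, $d(p_i)=2$ for $1\le i\le\ell-1$ and $d(p_\ell)=1$. -}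

module Defs where

open import Data.Nat using (ℕ; zero; suc; _+_; _*_; _^_; _≤_; _<_; _≤ᵇ_; _<ᵇ_; _≡ᵇ_)
open import Data.Bool using (Bool; true; false; if_then_else_; _∧_; _∨_)
open import Data.Fin using (Fin; toℕ; _≟_)
open import Data.Nat.ListAction using (sum)
open import Data.List using (List; []; _∷_; [_]; map; concatMap; zip; drop; take; _++_; length)
open import Data.List.Relation.Unary.All using (All)
open import Data.List.Relation.Unary.Linked using (Linked)
open import Data.List.Relation.Unary.Unique.Propositional using (Unique)
open import Data.List.Membership.Propositional using (_∈_; _∉_)
open import Data.Product using (_×_; _,_; proj₁; proj₂; ∃)
open import Data.Sum using (_⊎_)
open import Relation.Binary.PropositionalEquality using (_≡_)
open import Relation.Nullary.Decidable using (⌊_⌋)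
open import Data.List.Base using (allFin)

Adj : ℕ → Set
Adj N = Fin N → Fin N → Bool

Edge : ∀ {N} → Adj N → Fin N → Fin N → Set
Edge adj x y = adj x y ≡ true

IsSimple : ∀ {N} → Adj N → Set
IsSimple {N} adj = (∀ x y → adj x y ≡ adj y x) × (∀ x → adj x x ≡ false)

deg : ∀ {N} → Adj N → Fin N → ℕ
deg {N} adj x = sum (map (λ y → if adj x y then 1 else 0) (allFin N))

pendantCount : ∀ {N} → Adj N → ℕ
pendantCount {N} adj = sum (map (λ x → if deg adj x ≡ᵇ 1 then 1 else 0) (allFin N))

edges : ∀ {N} → Adj N → List (Fin N × Fin N)
edges {N} adj = concatMap (λ x → concatMap (λ y →
  if (toℕ x <ᵇ toℕ y) ∧ adj x y then [ (x , y) ] else []) (allFin N)) (allFin N)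

data Walk {N} (adj : Adj N) : Fin N → Fin N → Set where
  here : ∀ {x} → Walk adj x x
  step : ∀ {x y z} → Edge adj x y → Walk adj y z → Walk adj x z

Connected : ∀ {N} → Adj N → Set
Connected adj = ∀ x y → Walk adj x y

cycEdges : ∀ {N} → List (Fin N) → List (Fin N × Fin N)
cycEdges c = zip c (drop 1 c ++ take 1 c)

IsCycle : ∀ {N} → Adj N → List (Fin N) → Set
IsCycle adj c = (3 ≤ length c) × Unique c × All (λ e → Edge adj (proj₁ e) (proj₂ e)) (cycEdges c)

CycEdge : ∀ {N} → List (Fin N) → Fin N → Fin N → Set
CycEdge c a b = ((a , b) ∈ cycEdges c) ⊎ ((b , a) ∈ cycEdges c)

-- connected graph with exactly one cycle (as a subgraph), namely c
Unicyclic : ∀ {N} → Adj N → List (Fin N) → Set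
Unicyclic adj c = Connected adj × IsCycle adj c ×
  (∀ c' → IsCycle adj c' → ∀ a b → (CycEdge c a b → CycEdge c' a b) × (CycEdge c' a b → CycEdge c a b))

data PendantTail {N} (adj : Adj N) (c : List (Fin N)) : List (Fin N) → Set where
  lastV : ∀ {x} → x ∉ c → deg adj x ≡ 1 → PendantTail adj c (x ∷ [])
  midV  : ∀ {x y ys} → x ∉ c → deg adj x ≡ 2 → PendantTail adj c (y ∷ ys) → PendantTail adj c (x ∷ y ∷ ys)

-- pendant path u = p0 ∼ p1 ∼ … ∼ pl attached at u, given by ps = p1 … pl; its length is length ps
PendantPath : ∀ {N} → Adj N → List (Fin N) → Fin N → List (Fin N) → Set
PendantPath adj c u ps = Linked (Edge adj) (u ∷ ps) × Unique (u ∷ ps) × PendantTail adj c ps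

transform : ∀ {N} → Adj N → Fin N → Fin N → Fin N → Adj N
transform adj v1 v2 um x y =
  if (⌊ x ≟ v2 ⌋ ∧ ⌊ y ≟ v1 ⌋) ∨ (⌊ x ≟ v1 ⌋ ∧ ⌊ y ≟ v2 ⌋) then false
  else if (⌊ x ≟ um ⌋ ∧ ⌊ y ≟ v2 ⌋) ∨ (⌊ x ≟ v2 ⌋ ∧ ⌊ y ≟ um ⌋) then true
  else adj x y

-- Sombor index as the list of radicands d(x)^2 + d(y)^2 over edges: SO = Σ √(term)
soTerms : ∀ {N} → Adj N → List ℕ
soTerms adj = map (λ e → deg adj (proj₁ e) ^ 2 + deg adj (proj₂ e) ^ 2) (edges adj)

isqrtAux : ℕ → ℕ → ℕ
isqrtAux zero x = 0
isqrtAux (suc r) x = if suc r * suc r ≤ᵇ x then suc r else isqrtAux r x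

isqrt : ℕ → ℕ
isqrt x = isqrtAux x x

-- Σ √a (a ∈ as)  <  Σ √b (b ∈ bs)  as real numbers, expressed exactly via dyadic
-- approximations: some precision 2^n separates upper bounds of the left from lower bounds of the right.
SqrtSumLt : List ℕ → List ℕ → Set
SqrtSumLt as bs = ∃ λ n →
  sum (map (λ a → isqrt (a * 4 ^ n) + 1) as) < sum (map (λ b → isqrt (b * 4 ^ n)) bs)

SOLt : ∀ {N} → Adj N → Adj N → Set
SOLt g h = SqrtSumLt (soTerms g) (soTerms h)

-- Moving v₂ from the end of the pendant path u v₁ v₂ to the end uₘ of the other
-- pendant path (whose last edge is w uₘ) changes the terms of only four edges,
-- with d = d(u) ≥ 3: u v₁ goes from √(d² + 4) to √(d² + 1), v₁ v₂ (√5) disappears,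
-- w uₘ goes from √5 to √8, and the new edge uₘ v₂ contributes √5.  Hence
-- SO(G*) − SO(G) = (√8 − √5) − (√(d² + 4) − √(d² + 1)) ≥ 0.59 − 0.45 > 0.
-- To compare the two sums of square roots exactly, each √s is bracketed between
-- ⌊√(s·4ⁿ)⌋ and ⌊√(s·4ⁿ)⌋ + 1 with 2ⁿ = 64K, K = 2^(N²).  The gains and losses
-- above are charged, as multiples of K, to the pairs of vertices where they occur,
-- and one unit per pair absorbs the rounding; the charged inequality then holds
-- pair by pair, and summing it gives the claim because there are fewer than K pairs.

{-# OPTIONS --safe #-}
module Submission where

open import Defs
open import Data.Nat using (ℕ; zero; suc; _+_; _*_; _^_; _≤_; _<_; _≤ᵇ_; _<ᵇ_; z≤n; s≤s)
open import Data.Nat.Properties hiding (_≟_)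
open import Data.Bool using (Bool; true; false; if_then_else_; _∧_; _∨_)
open import Data.Bool.Properties using (∧-comm; ∨-comm; T-∨; T-∧; T-≡; ¬-not)
open import Relation.Binary.Definitions using (tri<; tri≈; tri>)
open import Data.Fin using (Fin; toℕ; _≟_) renaming (zero to fzero; suc to fsuc)
import Data.Fin.Properties as Fin
open import Data.Nat.ListAction using (sum)
open import Data.List using (List; []; _∷_; [_]; _++_; _∷ʳ_; zip; map; concatMap; tabulate; allFin; length)
open import Data.List.Properties using (map-tabulate; tabulate-cong; map-∘; map-++; length-++)
open import Data.Nat.ListAction.Properties using (sum-++)
open import Data.List.Relation.Unary.All as All using (All; []; _∷_)
open import Data.List.Relation.Unary.AllPairs using ([]; _∷_)
open import Data.List.Relation.Unary.Unique.Propositional using (Unique)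
open import Data.List.Relation.Unary.Linked using (Linked; [-]; _∷_)
open import Data.List.Relation.Unary.Any using (here; there)
open import Data.List.Membership.Propositional using (_∈_; _∉_)
open import Data.List.Membership.Propositional.Properties using (∈-++⁻; ∈-++⁺ˡ; ∈-++⁺ʳ)
open import Data.Product using (_×_; _,_; proj₁; proj₂; ∃)
open import Data.Sum using (_⊎_; inj₁; inj₂)
open import Function using (_∘_; id; Equivalence)
open import Relation.Nullary using (¬_; Dec; yes; no; contradiction)
open import Data.Empty using (⊥; ⊥-elim)
open import Relation.Nullary.Decidable using (⌊_⌋; isYes≗does; dec-true; dec-false; toWitness)
open import Relation.Binary.PropositionalEquality hiding ([_])
open import Data.Nat.Tactic.RingSolver using (solve-∀)

-- Finite sums

when : Bool → ℕ → ℕ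
when b n = if b then n else 0

when-+ : ∀ b m n → when b (m + n) ≡ when b m + when b n
when-+ true  m n = refl
when-+ false m n = refl

when-mono-≤ : ∀ b {m n} → m ≤ n → when b m ≤ when b n
when-mono-≤ true  m≤n = m≤n
when-mono-≤ false m≤n = z≤n

when-≤ : ∀ b n → when b n ≤ n
when-≤ true  n = ≤-refl
when-≤ false n = z≤n

when-false : ∀ {b} n → b ≡ false → when b n ≡ 0
when-false n refl = refl

when-true : ∀ {b} n → b ≡ true → when b n ≡ n
when-true n refl = refl

when-0 : ∀ b → when b 0 ≡ 0
when-0 true  = refl
when-0 false = refl

∑ : ∀ {n} → (Fin n → ℕ) → ℕ
∑ f = sum (tabulate f)

∑-cong : ∀ {n} {f g : Fin n → ℕ} → (∀ i → f i ≡ g i) → ∑ f ≡ ∑ g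
∑-cong f≗g = cong sum (tabulate-cong f≗g)

∑-+ : ∀ {n} (f g : Fin n → ℕ) → ∑ (λ i → f i + g i) ≡ ∑ f + ∑ g
∑-+ {zero}  f g = refl
∑-+ {suc n} f g = begin
  f fzero + g fzero + ∑ (λ i → f (fsuc i) + g (fsuc i))  ≡⟨ cong (f fzero + g fzero +_) (∑-+ (f ∘ fsuc) (g ∘ fsuc)) ⟩
  f fzero + g fzero + (∑ (f ∘ fsuc) + ∑ (g ∘ fsuc))      ≡⟨ interchange (f fzero) (g fzero) _ _ ⟩
  f fzero + ∑ (f ∘ fsuc) + (g fzero + ∑ (g ∘ fsuc))      ∎
  where
  open ≡-Reasoning
  interchange : ∀ a b c d → a + b + (c + d) ≡ a + c + (b + d)
  interchange = solve-∀

∑-mono-≤ : ∀ {n} {f g : Fin n → ℕ} → (∀ i → f i ≤ g i) → ∑ f ≤ ∑ g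
∑-mono-≤ {zero}  f≤g = z≤n
∑-mono-≤ {suc n} f≤g = +-mono-≤ (f≤g fzero) (∑-mono-≤ (f≤g ∘ fsuc))

∑-const : ∀ n c → ∑ {n} (λ _ → c) ≡ n * c
∑-const zero    c = refl
∑-const (suc n) c = cong (c +_) (∑-const n c)

∑-zero : ∀ {n} {f : Fin n → ℕ} → (∀ i → f i ≡ 0) → ∑ f ≡ 0
∑-zero {n} f≗0 = trans (∑-cong f≗0) (trans (∑-const n 0) (*-zeroʳ n))

∑-single : ∀ {n} {f : Fin n → ℕ} (a : Fin n) → (∀ i → i ≢ a → f i ≡ 0) → ∑ f ≡ f a
∑-single {suc n} {f} fzero    f≗0 =
  trans (cong (f fzero +_) (∑-zero (λ i → f≗0 (fsuc i) λ ()))) (+-identityʳ _)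
∑-single {suc n} {f} (fsuc a) f≗0 =
  cong₂ _+_ (f≗0 fzero λ ()) (∑-single a (λ i i≢a → f≗0 (fsuc i) (i≢a ∘ Fin.suc-injective)))

∑₂ : ∀ {n} → (Fin n → Fin n → ℕ) → ℕ
∑₂ f = ∑ λ x → ∑ (f x)

∑₂-+ : ∀ {n} (f g : Fin n → Fin n → ℕ) → ∑₂ (λ x y → f x y + g x y) ≡ ∑₂ f + ∑₂ g
∑₂-+ f g = trans (∑-cong (λ x → ∑-+ (f x) (g x))) (∑-+ (∑ ∘ f) (∑ ∘ g))

∑₂-mono-≤ : ∀ {n} {f g : Fin n → Fin n → ℕ} → (∀ x y → f x y ≤ g x y) → ∑₂ f ≤ ∑₂ g
∑₂-mono-≤ f≤g = ∑-mono-≤ (λ x → ∑-mono-≤ (f≤g x))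

∑₂-single : ∀ {n} {f : Fin n → Fin n → ℕ} (a b : Fin n) →
            (∀ x y → ¬ (x ≡ a × y ≡ b) → f x y ≡ 0) → ∑₂ f ≡ f a b
∑₂-single a b f≗0 = trans (∑-single a (λ x x≢a → ∑-zero (λ y → f≗0 x y (x≢a ∘ proj₁))))
                          (∑-single b (λ y y≢b → f≗0 a y (y≢b ∘ proj₂)))

∑₂-const : ∀ n c → ∑₂ {n} (λ _ _ → c) ≡ n * (n * c)
∑₂-const n c = trans (∑-cong {n} (λ _ → ∑-const n c)) (∑-const n (n * c))

sum-map-allFin : ∀ n (f : Fin n → ℕ) → sum (map f (allFin n)) ≡ ∑ f
sum-map-allFin n f = cong sum (map-tabulate id f)

sum-map-concatMap : ∀ {a b} {X : Set a} {Y : Set b} (g : Y → ℕ) (h : X → List Y) xs →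
                    sum (map g (concatMap h xs)) ≡ sum (map (λ x → sum (map g (h x))) xs)
sum-map-concatMap g h []       = refl
sum-map-concatMap g h (x ∷ xs) = begin
  sum (map g (h x ++ concatMap h xs))                    ≡⟨ cong sum (map-++ g (h x) _) ⟩
  sum (map g (h x) ++ map g (concatMap h xs))            ≡⟨ sum-++ (map g (h x)) _ ⟩
  sum (map g (h x)) + sum (map g (concatMap h xs))       ≡⟨ cong (sum (map g (h x)) +_) (sum-map-concatMap g h xs) ⟩
  sum (map g (h x)) + sum (map (λ x → sum (map g (h x))) xs) ∎
  where open ≡-Reasoning

-- Unordered pairs of vertices

≟-refl : ∀ {n} (x : Fin n) → ⌊ x ≟ x ⌋ ≡ true
≟-refl x = trans (isYes≗does (x ≟ x)) (dec-true (x ≟ x) refl)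

≟-≢ : ∀ {n} {x y : Fin n} → x ≢ y → ⌊ x ≟ y ⌋ ≡ false
≟-≢ {x = x} {y} x≢y = trans (isYes≗does (x ≟ y)) (dec-false (x ≟ y) x≢y)

isPair : ∀ {n} → Fin n → Fin n → Fin n → Fin n → Bool
isPair a b x y = (⌊ x ≟ a ⌋ ∧ ⌊ y ≟ b ⌋) ∨ (⌊ x ≟ b ⌋ ∧ ⌊ y ≟ a ⌋)

isPair-refl : ∀ {n} (a b : Fin n) → isPair a b a b ≡ true
isPair-refl a b rewrite ≟-refl a | ≟-refl b = refl

isPair-comm : ∀ {n} (a b x y : Fin n) → isPair a b x y ≡ isPair b a x y
isPair-comm a b x y = ∨-comm (⌊ x ≟ a ⌋ ∧ ⌊ y ≟ b ⌋) _

isPair-sym : ∀ {n} (a b x y : Fin n) → isPair a b x y ≡ isPair a b y x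
isPair-sym a b x y = trans (cong₂ _∨_ (∧-comm ⌊ x ≟ a ⌋ _) (∧-comm ⌊ x ≟ b ⌋ _))
                           (∨-comm (⌊ y ≟ b ⌋ ∧ ⌊ x ≟ a ⌋) _)

isPair-sound : ∀ {n} {a b x y : Fin n} → isPair a b x y ≡ true → (x ≡ a × y ≡ b) ⊎ (x ≡ b × y ≡ a)
isPair-sound {a = a} {b} {x} {y} eq with Equivalence.to (T-∨ {⌊ x ≟ a ⌋ ∧ ⌊ y ≟ b ⌋}) (Equivalence.from T-≡ eq)
... | inj₁ t = let p , q = Equivalence.to (T-∧ {⌊ x ≟ a ⌋}) t
              in inj₁ (toWitness {a? = x ≟ a} p , toWitness {a? = y ≟ b} q)
... | inj₂ t = let p , q = Equivalence.to (T-∧ {⌊ x ≟ b ⌋}) t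
              in inj₂ (toWitness {a? = x ≟ b} p , toWitness {a? = y ≟ a} q)

isPair-false : ∀ {n} {a b x y : Fin n} → ¬ (x ≡ a × y ≡ b) → ¬ (x ≡ b × y ≡ a) → isPair a b x y ≡ false
isPair-false {a = a} {b} {x} {y} ¬ab ¬ba with isPair a b x y in eq
... | false = refl
... | true with isPair-sound {a = a} {b} {x} {y} eq
...   | inj₁ ab = contradiction ab ¬ab
...   | inj₂ ba = contradiction ba ¬ba

isPair-outside : ∀ {n} {a b x : Fin n} y → x ≢ a → x ≢ b → isPair a b x y ≡ false
isPair-outside y x≢a x≢b = isPair-false (x≢a ∘ proj₁) (x≢b ∘ proj₁)

lt : ∀ {n} → Fin n → Fin n → Bool
lt x y = toℕ x <ᵇ toℕ y

lt-asym : ∀ {n} {x y : Fin n} → lt x y ≡ true → lt y x ≡ false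
lt-asym {x = x} {y} x<y with lt y x in y<x
... | false = refl
... | true  = contradiction (<ᵇ⇒< (toℕ y) (toℕ x) (Equivalence.from T-≡ y<x))
                            (<⇒≯ (<ᵇ⇒< (toℕ x) (toℕ y) (Equivalence.from T-≡ x<y)))

lt-connex : ∀ {n} {x y : Fin n} → x ≢ y → lt x y ≡ false → lt y x ≡ true
lt-connex {x = x} {y} x≢y x≮y with Fin.<-cmp x y
... | tri< x<y _ _ = contradiction (trans (sym x≮y) (Equivalence.to T-≡ (<⇒<ᵇ x<y))) λ ()
... | tri≈ _ x≡y _ = contradiction x≡y x≢y
... | tri> _ _ y<x = Equivalence.to T-≡ (<⇒<ᵇ y<x)

∑< : ∀ {n} → (Fin n → Fin n → ℕ) → ℕ
∑< f = ∑₂ (λ x y → when (lt x y) (f x y))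

∑<-+ : ∀ {n} (f g : Fin n → Fin n → ℕ) → ∑< (λ x y → f x y + g x y) ≡ ∑< f + ∑< g
∑<-+ f g = trans (∑-cong (λ x → ∑-cong (λ y → when-+ (lt x y) (f x y) (g x y))))
                 (∑₂-+ (λ x y → when (lt x y) (f x y)) (λ x y → when (lt x y) (g x y)))

∑<-mono-≤ : ∀ {n} {f g : Fin n → Fin n → ℕ} → (∀ x y → f x y ≤ g x y) → ∑< f ≤ ∑< g
∑<-mono-≤ f≤g = ∑₂-mono-≤ (λ x y → when-mono-≤ (lt x y) (f≤g x y))

∑<-1 : ∀ n → ∑< {n} (λ _ _ → 1) ≤ n * n
∑<-1 n = begin
  ∑< {n} (λ _ _ → 1)   ≤⟨ ∑₂-mono-≤ {n} (λ x y → when-≤ (lt x y) 1) ⟩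
  ∑₂ {n} (λ _ _ → 1)   ≡⟨ ∑₂-const n 1 ⟩
  n * (n * 1)          ≡⟨ cong (n *_) (*-identityʳ n) ⟩
  n * n                ∎
  where open ≤-Reasoning

∑<-pair-ordered : ∀ {n} (a b : Fin n) c → lt a b ≡ true → ∑< (λ x y → when (isPair a b x y) c) ≡ c
∑<-pair-ordered a b c a<b = trans (∑₂-single a b vanish) value
  where
  value : when (lt a b) (when (isPair a b a b) c) ≡ c
  value rewrite a<b | isPair-refl a b = refl
  vanish : ∀ x y → ¬ (x ≡ a × y ≡ b) → when (lt x y) (when (isPair a b x y) c) ≡ 0
  vanish x y ¬ab with isPair a b x y in ab?
  ... | false = when-0 (lt x y)
  ... | true with isPair-sound {a = a} {b} {x} {y} ab?
  ...   | inj₁ ab = contradiction ab ¬ab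
  ...   | inj₂ (refl , refl) = when-false c (lt-asym {x = a} a<b)

∑<-pair : ∀ {n} (a b : Fin n) c → a ≢ b → ∑< (λ x y → when (isPair a b x y) c) ≡ c
∑<-pair a b c a≢b with lt a b in a<b
... | true  = ∑<-pair-ordered a b c a<b
... | false = begin
  ∑< (λ x y → when (isPair a b x y) c)  ≡⟨ ∑-cong (λ x → ∑-cong (λ y → cong (λ p → when (lt x y) (when p c))
                                                                              (isPair-comm a b x y))) ⟩
  ∑< (λ x y → when (isPair b a x y) c)  ≡⟨ ∑<-pair-ordered b a c (lt-connex a≢b a<b) ⟩
  c                                     ∎
  where open ≡-Reasoning

module _ {n : ℕ} where
  open import Data.List.Membership.DecPropositional (_≟_ {n}) using (_∈?_)

  by-symmetry : {P : Fin n → Fin n → Set} → (∀ {x y} → P x y → P y x) → (S : List (Fin n)) →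
                (∀ {x} → x ∈ S → ∀ y → P x y) → (∀ {x y} → x ∉ S → y ∉ S → P x y) → ∀ x y → P x y
  by-symmetry swap S inside outside x y with x ∈? S | y ∈? S
  ... | yes x∈S | _       = inside x∈S y
  ... | no _    | yes y∈S = swap (inside y∈S x)
  ... | no x∉S  | no y∉S  = outside x∉S y∉S

-- Degrees

count : ∀ {n} → (Fin n → Bool) → ℕ
count r = ∑ (λ y → when (r y) 1)

deg≡count : ∀ {N} (A : Adj N) x → deg A x ≡ count (A x)
deg≡count {N} A x = sum-map-allFin N (λ y → when (A x y) 1)

count-cong : ∀ {n} {r s : Fin n → Bool} → (∀ y → r y ≡ s y) → count r ≡ count s
count-cong r≗s = ∑-cong (λ y → cong (λ b → when b 1) (r≗s y))

∑-indicator : ∀ {n} (a : Fin n) → ∑ (λ y → when ⌊ y ≟ a ⌋ 1) ≡ 1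
∑-indicator a = trans (∑-single a (λ y y≢a → when-false 1 (≟-≢ y≢a))) (when-true 1 (≟-refl a))

count-insert : ∀ {n} {r s : Fin n → Bool} (a : Fin n) →
               r a ≡ false → s a ≡ true → (∀ y → y ≢ a → r y ≡ s y) → count s ≡ suc (count r)
count-insert {r = r} {s} a ra sa r≗s = begin
  count s                                    ≡⟨ ∑-cong pointwise ⟩
  ∑ (λ y → when (r y) 1 + when ⌊ y ≟ a ⌋ 1)  ≡⟨ ∑-+ (λ y → when (r y) 1) _ ⟩
  count r + ∑ (λ y → when ⌊ y ≟ a ⌋ 1)       ≡⟨ cong (count r +_) (∑-indicator a) ⟩
  count r + 1                                ≡⟨ +-comm _ 1 ⟩
  suc (count r)                              ∎
  where
  open ≡-Reasoning
  pointwise : ∀ y → when (s y) 1 ≡ when (r y) 1 + when ⌊ y ≟ a ⌋ 1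
  pointwise y with y ≟ a
  ... | yes refl rewrite ra | sa = refl
  ... | no y≢a rewrite r≗s y y≢a = sym (+-identityʳ _)

remove : ∀ {n} → (Fin n → Bool) → Fin n → Fin n → Bool
remove r a y = if ⌊ y ≟ a ⌋ then false else r y

remove-at : ∀ {n} (r : Fin n → Bool) a → remove r a a ≡ false
remove-at r a rewrite ≟-refl a = refl

remove-other : ∀ {n} (r : Fin n → Bool) {a y} → y ≢ a → remove r a y ≡ r y
remove-other r y≢a rewrite ≟-≢ y≢a = refl

count-remove : ∀ {n} {r : Fin n → Bool} (a : Fin n) → r a ≡ true → count r ≡ suc (count (remove r a))
count-remove {r = r} a ra = count-insert a (remove-at r a) ra (λ y → remove-other r)

length-≤-count : ∀ {n} {r : Fin n → Bool} {as : List (Fin n)} →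
                 Unique as → All (λ a → r a ≡ true) as → length as ≤ count r
length-≤-count {as = []}     _                _          = z≤n
length-≤-count {r = r} {as = a ∷ as} (a∉as ∷ unique) (ra ∷ ras) = begin
  suc (length as)          ≤⟨ s≤s (length-≤-count unique (All.zipWith still-there (a∉as , ras))) ⟩
  suc (count (remove r a)) ≡⟨ count-remove a ra ⟨
  count r                  ∎
  where
  open ≤-Reasoning
  still-there : ∀ {b} → a ≢ b × r b ≡ true → remove r a b ≡ true
  still-there (a≢b , rb) rewrite ≟-≢ (a≢b ∘ sym) = rb

length-≤-deg : ∀ {N} (A : Adj N) x {as : List (Fin N)} → Unique as → All (Edge A x) as → length as ≤ deg A x
length-≤-deg A x unique edges = subst (_ ≤_) (sym (deg≡count A x)) (length-≤-count unique edges)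

≢-by-deg : ∀ {N} {A : Adj N} {x y} → deg A y < deg A x → x ≢ y
≢-by-deg lt refl = <-irrefl refl lt

module _ {N} (A : Adj N) (x : Fin N) where

  neighbour-of-deg₂ : deg A x ≡ 2 → ∀ {a b c} → Edge A x a → Edge A x b → a ≢ b → Edge A x c → c ≡ a ⊎ c ≡ b
  neighbour-of-deg₂ d≡2 {a} {b} {c} xa xb a≢b xc with c ≟ a | c ≟ b
  ... | yes c≡a | _       = inj₁ c≡a
  ... | no _    | yes c≡b = inj₂ c≡b
  ... | no c≢a  | no c≢b  =
    contradiction (subst (3 ≤_) d≡2 (length-≤-deg A x unique (xa ∷ xb ∷ xc ∷ []))) (<-irrefl refl)
    where
    unique : Unique (a ∷ b ∷ c ∷ [])
    unique = (a≢b ∷ (c≢a ∘ sym) ∷ []) ∷ ((c≢b ∘ sym) ∷ []) ∷ [] ∷ []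

  neighbour-of-deg₁ : deg A x ≡ 1 → ∀ {a c} → Edge A x a → Edge A x c → c ≡ a
  neighbour-of-deg₁ d≡1 {a} {c} xa xc with c ≟ a
  ... | yes c≡a = c≡a
  ... | no c≢a  = contradiction (subst (2 ≤_) d≡1 (length-≤-deg A x unique (xa ∷ xc ∷ []))) (<-irrefl refl)
    where
    unique : Unique (a ∷ c ∷ [])
    unique = ((c≢a ∘ sym) ∷ []) ∷ [] ∷ []

three-neighbours≤deg : ∀ {N} (A : Adj N) x {a b c} → Edge A x a → Edge A x b → Edge A x c →
                       a ≢ b → a ≢ c → b ≢ c → 3 ≤ deg A x
three-neighbours≤deg A x xa xb xc a≢b a≢c b≢c =
  length-≤-deg A x ((a≢b ∷ a≢c ∷ []) ∷ (b≢c ∷ []) ∷ [] ∷ []) (xa ∷ xb ∷ xc ∷ [])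

-- Cycles and pendant paths

zip-∈ : ∀ {a b} {X : Set a} {Y : Set b} {x : X} (xs : List X) (ys : List Y) →
        x ∈ xs → length xs ≤ length ys → ∃ λ y → y ∈ ys × (x , y) ∈ zip xs ys
zip-∈ (x ∷ xs) (y ∷ ys) (here refl) _         = y , here refl , here refl
zip-∈ (_ ∷ xs) (_ ∷ ys) (there x∈xs) (s≤s le) =
  let y , y∈ys , xy∈ = zip-∈ xs ys x∈xs le in y , there y∈ys , there xy∈

cycle-neighbour : ∀ {N} {A : Adj N} {c u} → IsCycle A c → u ∈ c → ∃ λ z → z ∈ c × Edge A u z
cycle-neighbour {c = x ∷ xs} (_ , _ , edges) u∈c
  with zip-∈ (x ∷ xs) (xs ++ x ∷ []) u∈c (≤-reflexive (sym (trans (length-++ xs) (+-comm (length xs) 1))))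
... | z , z∈ , uz∈ = z , rotate (∈-++⁻ xs z∈) , All.lookup edges uz∈
  where
  rotate : ∀ {z} → z ∈ xs ⊎ z ∈ x ∷ [] → z ∈ x ∷ xs
  rotate (inj₁ z∈xs)       = there z∈xs
  rotate (inj₂ (here z≡x)) = here z≡x

module _ {N} {A : Adj N} {c : List (Fin N)} where

  pendantTail-head : ∀ {q qs} → PendantTail A c (q ∷ qs) → q ∉ c
  pendantTail-head (lastV q∉c _)  = q∉c
  pendantTail-head (midV q∉c _ _) = q∉c

  pendantTail-last : ∀ qs {z} → PendantTail A c (qs ∷ʳ z) → deg A z ≡ 1
  pendantTail-last []           (lastV _ d≡1)  = d≡1
  pendantTail-last (_ ∷ [])     (midV _ _ tail) = pendantTail-last [] tail
  pendantTail-last (_ ∷ q ∷ qs) (midV _ _ tail) = pendantTail-last (q ∷ qs) tail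

  penultimate : ∀ {p} a qs {z} → Linked (Edge A) (p ∷ a ∷ qs ∷ʳ z) → PendantTail A c (a ∷ qs ∷ʳ z) →
                ∃ λ w → w ∈ a ∷ qs × Edge A w z × deg A w ≡ 2
  penultimate a []       (_ ∷ az ∷ _) (midV _ d≡2 _)  = a , here refl , az , d≡2
  penultimate a (q ∷ qs) (_ ∷ linked) (midV _ _ tail) =
    let w , w∈ , wz , d≡2 = penultimate q qs linked tail in w , there w∈ , wz , d≡2

linked-avoids : ∀ {N} {A : Adj N} {P : Fin N → Set} {u} → (∀ {p q} → Edge A p q → P q → P p ⊎ p ≡ u) →
                ∀ {p qs} → Linked (Edge A) (p ∷ qs) → ¬ P p → u ≢ p → All (u ≢_) qs → All (λ q → ¬ P q) qs
linked-avoids closed [-]           _   _   []            = []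
linked-avoids {P = P} closed (_∷_ {y = q} pq linked) ¬Pp u≢p (u≢q ∷ u≢qs) =
  ¬Pq ∷ linked-avoids closed linked ¬Pq u≢q u≢qs
  where
  ¬Pq : ¬ P q
  ¬Pq Pq with closed pq Pq
  ... | inj₁ Pp  = ¬Pp Pp
  ... | inj₂ p≡u = u≢p (sym p≡u)

module _ {N} {A : Adj N} (symmetric : ∀ x y → A x y ≡ A y x) {c : List (Fin N)} {u v₁ v₂ : Fin N}
         (uv₁ : Edge A u v₁) (v₁v₂ : Edge A v₁ v₂) (u≢v₁ : u ≢ v₁) (u≢v₂ : u ≢ v₂)
         (d₁≡2 : deg A v₁ ≡ 2) (d₂≡1 : deg A v₂ ≡ 1) where

  private
    neighbour-of-v₁ : ∀ {p} → Edge A v₁ p → p ≡ u ⊎ p ≡ v₂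
    neighbour-of-v₁ = neighbour-of-deg₂ A v₁ d₁≡2 (trans (symmetric v₁ u) uv₁) v₁v₂ u≢v₂

    neighbour-of-v₂ : ∀ {p} → Edge A v₂ p → p ≡ v₁
    neighbour-of-v₂ = neighbour-of-deg₁ A v₂ d₂≡1 (trans (symmetric v₂ v₁) v₁v₂)

    closed : ∀ {p q} → Edge A p q → q ≡ v₁ ⊎ q ≡ v₂ → (p ≡ v₁ ⊎ p ≡ v₂) ⊎ p ≡ u
    closed pq (inj₁ refl) with neighbour-of-v₁ (trans (symmetric v₁ _) pq)
    ... | inj₁ p≡u  = inj₂ p≡u
    ... | inj₂ p≡v₂ = inj₁ (inj₂ p≡v₂)
    closed pq (inj₂ refl) = inj₁ (inj₁ (neighbour-of-v₂ (trans (symmetric v₂ _) pq)))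

    through-v₁ : ∀ qs → Linked (Edge A) (v₁ ∷ qs) → PendantTail A c (v₁ ∷ qs) → All (u ≢_) qs →
                 v₁ ∷ v₂ ∷ [] ≢ v₁ ∷ qs → ⊥
    through-v₁ [] _ (lastV _ d≡1) _ _ = contradiction (trans (sym d≡1) d₁≡2) λ ()
    through-v₁ (q ∷ qs) (v₁q ∷ _) tail (u≢q ∷ _) qs≢ with neighbour-of-v₁ v₁q
    ... | inj₁ refl = u≢q refl
    through-v₁ (q ∷ [])    _ _                         _ qs≢ | inj₂ refl = qs≢ refl
    through-v₁ (q ∷ _ ∷ _) _ (midV _ _ (midV _ d≡2 _)) _ _   | inj₂ refl =
      contradiction (trans (sym d₂≡1) d≡2) λ ()

  pendant-path-avoids : ∀ {qs} → PendantPath A c u qs → v₁ ∷ v₂ ∷ [] ≢ qs →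
                        All (λ q → ¬ (q ≡ v₁ ⊎ q ≡ v₂)) qs
  pendant-path-avoids {q ∷ qs} (uq ∷ linked , (u≢q ∷ u≢qs) ∷ _ , tail) qs≢ with q ≟ v₁ | q ≟ v₂
  ... | _        | yes refl = contradiction (neighbour-of-v₂ (trans (symmetric v₂ u) uq)) u≢v₁
  ... | yes refl | no _     = ⊥-elim (through-v₁ qs linked tail u≢qs qs≢)
  ... | no q≢v₁  | no q≢v₂  = ¬near ∷ linked-avoids closed linked ¬near u≢q u≢qs
    where
    ¬near : ¬ (q ≡ v₁ ⊎ q ≡ v₂)
    ¬near (inj₁ q≡v₁) = q≢v₁ q≡v₁
    ¬near (inj₂ q≡v₂) = q≢v₂ q≡v₂

-- The Sombor index as a sum over pairs

edgeTerm : ∀ {N} → Adj N → (ℕ → ℕ) → Fin N → Fin N → ℕ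
edgeTerm A f x y = when (A x y) (f (deg A x ^ 2 + deg A y ^ 2))

sum-soTerms : ∀ {N} (A : Adj N) (f : ℕ → ℕ) → sum (map f (soTerms A)) ≡ ∑< (edgeTerm A f)
sum-soTerms {N} A f = begin
  sum (map f (soTerms A))                                ≡⟨ cong sum (map-∘ (edges A)) ⟨
  sum (map g (edges A))                                  ≡⟨ sum-map-concatMap g (λ x → concatMap (cell x) (allFin N)) (allFin N) ⟩
  sum (map (λ x → sum (map g (concatMap (cell x) (allFin N)))) (allFin N)) ≡⟨ sum-map-allFin N _ ⟩
  ∑ (λ x → sum (map g (concatMap (cell x) (allFin N))))  ≡⟨ ∑-cong row ⟩
  ∑< (edgeTerm A f)                                      ∎
  where
  open ≡-Reasoning
  g : Fin N × Fin N → ℕ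
  g (x , y) = f (deg A x ^ 2 + deg A y ^ 2)
  cell : Fin N → Fin N → List (Fin N × Fin N)
  cell x y = if lt x y ∧ A x y then [ (x , y) ] else []
  cell-sum : ∀ x y → sum (map g (cell x y)) ≡ when (lt x y) (edgeTerm A f x y)
  cell-sum x y with lt x y | A x y
  ... | true  | true  = +-identityʳ _
  ... | true  | false = refl
  ... | false | _     = refl
  row : ∀ x → sum (map g (concatMap (cell x) (allFin N))) ≡ ∑ (λ y → when (lt x y) (edgeTerm A f x y))
  row x = trans (sum-map-concatMap g (cell x) (allFin N)) (trans (sum-map-allFin N _) (∑-cong (cell-sum x)))

edgeTerm-edge : ∀ {N} (A : Adj N) f x y {p q} → Edge A x y → deg A x ≡ p → deg A y ≡ q →
                edgeTerm A f x y ≡ f (p ^ 2 + q ^ 2)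
edgeTerm-edge A f x y xy refl refl rewrite xy = refl

edgeTerm-non : ∀ {N} (A : Adj N) f x y → A x y ≡ false → edgeTerm A f x y ≡ 0
edgeTerm-non A f x y ¬xy rewrite ¬xy = refl

edgeTerm-sym : ∀ {N} {A : Adj N} → (∀ x y → A x y ≡ A y x) → ∀ f x y → edgeTerm A f x y ≡ edgeTerm A f y x
edgeTerm-sym {A = A} symmetric f x y = cong₂ (λ b s → when b (f s)) (symmetric x y) (+-comm (deg A x ^ 2) _)

-- Integer square roots and the numerical constants

isqrtAux-sq≤ : ∀ r x → isqrtAux r x * isqrtAux r x ≤ x
isqrtAux-sq≤ zero    x = z≤n
isqrtAux-sq≤ (suc r) x with suc r * suc r ≤ᵇ x in fits
... | true  = ≤ᵇ⇒≤ (suc r * suc r) x (Equivalence.from T-≡ fits)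
... | false = isqrtAux-sq≤ r x

≤-isqrtAux : ∀ r x {s} → s * s ≤ x → s ≤ r → s ≤ isqrtAux r x
≤-isqrtAux zero    x _   s≤r = s≤r
≤-isqrtAux (suc r) x {s} s²≤x s≤r with suc r * suc r ≤ᵇ x in fits
... | true  = s≤r
... | false = ≤-isqrtAux r x s²≤x (<⇒≤pred (≤∧≢⇒< s≤r s≢))
  where
  s≢ : s ≢ suc r
  s≢ refl = contradiction (trans (sym (Equivalence.to T-≡ (≤⇒≤ᵇ s²≤x))) fits) λ ()

≤-isqrt : ∀ {x s} → s * s ≤ x → s ≤ isqrt x
≤-isqrt {x} {zero}  _    = z≤n
≤-isqrt {x} {suc s} s²≤x = ≤-isqrtAux x x s²≤x (≤-trans (m≤m*n (suc s) (suc s)) s²≤x)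

isqrt-< : ∀ {x s} → x < s * s → isqrt x < s
isqrt-< {x} {s} x<s² = ≰⇒> λ s≤√x → <⇒≱ x<s² (≤-trans (*-mono-≤ s≤√x s≤√x) (isqrtAux-sq≤ x x))

<-suc-isqrt² : ∀ x → x < suc (isqrt x) * suc (isqrt x)
<-suc-isqrt² x = ≰⇒> λ le → <-irrefl refl (≤-isqrt le)

module _ (K : ℕ) where

  private
    M X : ℕ
    M = 64 * K
    X = M * M

  isqrt[5X]<144K : 1 ≤ K → isqrt (5 * X) + 1 ≤ 144 * K
  isqrt[5X]<144K 1≤K = subst (_≤ 144 * K) (+-comm 1 _) (isqrt-< (subst (5 * X <_) (sym (square K)) (m<m+n _ 256K²>0)))
    where
    square : ∀ K → (144 * K) * (144 * K) ≡ 5 * ((64 * K) * (64 * K)) + 256 * (K * K)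
    square = solve-∀
    256K²>0 : 0 < 256 * (K * K)
    256K²>0 = ≤-trans (*-mono-≤ 1≤K 1≤K) (m≤n*m (K * K) 256)

  143K≤isqrt[5X] : 143 * K ≤ isqrt (5 * X)
  143K≤isqrt[5X] = ≤-isqrt (subst ((143 * K) * (143 * K) ≤_) (sym (square K)) (m≤m+n _ _))
    where
    square : ∀ K → 5 * ((64 * K) * (64 * K)) ≡ (143 * K) * (143 * K) + 31 * (K * K)
    square = solve-∀

  181K≤isqrt[8X] : 181 * K ≤ isqrt (8 * X)
  181K≤isqrt[8X] = ≤-isqrt (subst ((181 * K) * (181 * K) ≤_) (sym (square K)) (m≤m+n _ _))
    where
    square : ∀ K → 8 * ((64 * K) * (64 * K)) ≡ (181 * K) * (181 * K) + 7 * (K * K)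
    square = solve-∀

  isqrt-gap : ∀ d → 3 ≤ d → isqrt ((4 + d ^ 2) * X) + 1 ≤ isqrt ((1 + d ^ 2) * X) + (32 * K + 1)
  isqrt-gap d 3≤d = subst (_≤ a + t) (+-comm 1 _) (isqrt-< (subst₂ _<_ (sym (split d X)) (sym (expand a K)) bound))
    where
    a t : ℕ
    a = isqrt ((1 + d ^ 2) * X)
    t = 32 * K + 1
    split : ∀ d y → (4 + d * (d * 1)) * y ≡ (1 + d * (d * 1)) * y + 3 * y
    split = solve-∀
    expand : ∀ a K → (a + (32 * K + 1)) * (a + (32 * K + 1)) ≡
                     (a * a + 2 * a) + (a * (64 * K) + (32 * K + 1) * (32 * K + 1))
    expand = solve-∀
    dM≤a : d * M ≤ a
    dM≤a = ≤-isqrt (subst (d * M * (d * M) ≤_) (square d M) (m≤m+n _ _))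
      where
      square : ∀ d m → d * m * (d * m) + m * m ≡ (1 + d * (d * 1)) * (m * m)
      square = solve-∀
    below-a : (1 + d ^ 2) * X ≤ a * a + 2 * a
    below-a = <⇒≤pred (subst ((1 + d ^ 2) * X <_) (next-square a) (<-suc-isqrt² _))
      where
      next-square : ∀ a → suc a * suc a ≡ suc (a * a + 2 * a)
      next-square = solve-∀
    3X≤aM : 3 * X ≤ a * M
    3X≤aM = subst (_≤ a * M) (*-assoc 3 M M) (*-monoˡ-≤ M (≤-trans (*-monoˡ-≤ M 3≤d) dM≤a))
    bound : (1 + d ^ 2) * X + 3 * X < (a * a + 2 * a) + (a * M + t * t)
    bound = +-mono-≤-< below-a (subst (_≤ a * M + t * t) (+-comm (3 * X) 1) (+-mono-≤ 3X≤aM (*-mono-≤ 1≤t 1≤t)))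
      where
      1≤t : 1 ≤ t
      1≤t = m≤n+m 1 (32 * K)

n<2^n : ∀ n → n < 2 ^ n
n<2^n zero    = s≤s z≤n
n<2^n (suc n) = begin-strict
  suc n              ≡⟨ +-comm 1 n ⟩
  n + 1              <⟨ +-mono-<-≤ (n<2^n n) (m^n>0 2 n) ⟩
  2 ^ n + 2 ^ n      ≡⟨ cong (2 ^ n +_) (+-identityʳ (2 ^ n)) ⟨
  2 ^ suc n          ∎
  where open ≤-Reasoning

4^[6+n]≡[64·2^n]² : ∀ n → 4 ^ (6 + n) ≡ (64 * 2 ^ n) * (64 * 2 ^ n)
4^[6+n]≡[64·2^n]² n = trans (cong (λ z → 4 * (4 * (4 * (4 * (4 * (4 * z)))))) (4^n≡2^n*2^n n)) (regroup (2 ^ n))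
  where
  regroup : ∀ k → 4 * (4 * (4 * (4 * (4 * (4 * (k * k)))))) ≡ (64 * k) * (64 * k)
  regroup = solve-∀
  4^n≡2^n*2^n : ∀ n → 4 ^ n ≡ 2 ^ n * 2 ^ n
  4^n≡2^n*2^n zero    = refl
  4^n≡2^n*2^n (suc n) = trans (cong (4 *_) (4^n≡2^n*2^n n)) (square (2 ^ n))
    where
    square : ∀ k → 4 * (k * k) ≡ (2 * k) * (2 * k)
    square = solve-∀

absorb-budget : ∀ {a b p K} → p < K → a + (37 * K + 143 * K) ≤ b + (p + (32 * K + 1) + 144 * K) → a < b
absorb-budget {a} {b} {p} {K} p<K h = begin
  suc a      ≡⟨ +-comm 1 a ⟩
  a + 1      ≤⟨ +-monoʳ-≤ a (≤-trans (≤-trans (s≤s z≤n) p<K) (m≤n*m K 3)) ⟩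
  a + 3 * K  ≤⟨ +-cancelʳ-≤ (177 * K) (a + 3 * K) b shifted ⟩
  b          ∎
  where
  open ≤-Reasoning
  regroupˡ : ∀ a K → a + 3 * K + 177 * K ≡ a + (37 * K + 143 * K)
  regroupˡ = solve-∀
  regroupʳ : ∀ b p K → b + (p + (32 * K + 1) + 144 * K) ≡ b + 176 * K + suc p
  regroupʳ = solve-∀
  regroupᵏ : ∀ b K → b + 176 * K + K ≡ b + 177 * K
  regroupᵏ = solve-∀
  shifted : a + 3 * K + 177 * K ≤ b + 177 * K
  shifted = begin
    a + 3 * K + 177 * K                  ≡⟨ regroupˡ a K ⟩
    a + (37 * K + 143 * K)               ≤⟨ h ⟩
    b + (p + (32 * K + 1) + 144 * K)     ≡⟨ regroupʳ b p K ⟩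
    b + 176 * K + suc p                  ≤⟨ +-monoʳ-≤ (b + 176 * K) p<K ⟩
    b + 176 * K + K                      ≡⟨ regroupᵏ b K ⟩
    b + 177 * K                          ∎

-- The transformation G ↦ G*

-- transform adj v₁ v₂ uₘ x y unfolds to
-- if isPair v₂ v₁ x y then false else if isPair uₘ v₂ x y then true else adj x y.
module Transform {N} (adj : Adj N) (v₁ v₂ uₘ : Fin N) where

  private
    G* : Adj N
    G* = transform adj v₁ v₂ uₘ

  transform-removed : ∀ x y → isPair v₂ v₁ x y ≡ true → G* x y ≡ false
  transform-removed x y removed = cong (λ b → if b then false else if isPair uₘ v₂ x y then true else adj x y) removed

  transform-added : ∀ x y → isPair v₂ v₁ x y ≡ false → isPair uₘ v₂ x y ≡ true → G* x y ≡ true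
  transform-added x y kept added = cong₂ (λ b c → if b then false else if c then true else adj x y) kept added

  transform-unchanged : ∀ x y → isPair v₂ v₁ x y ≡ false → isPair uₘ v₂ x y ≡ false → G* x y ≡ adj x y
  transform-unchanged x y kept absent = cong₂ (λ b c → if b then false else if c then true else adj x y) kept absent

  transform-symmetric : (∀ x y → adj x y ≡ adj y x) → ∀ x y → G* x y ≡ G* y x
  transform-symmetric symmetric x y = begin
    G* x y                                                                 ≡⟨⟩
    (if isPair v₂ v₁ x y then false else if isPair uₘ v₂ x y then true else adj x y)
      ≡⟨ cong₂ (λ b c → if b then false else if c then true else adj x y) (isPair-sym v₂ v₁ x y) (isPair-sym uₘ v₂ x y) ⟩
    (if isPair v₂ v₁ y x then false else if isPair uₘ v₂ y x then true else adj x y)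
      ≡⟨ cong (λ a → if isPair v₂ v₁ y x then false else if isPair uₘ v₂ y x then true else a) (symmetric x y) ⟩
    G* y x                                                                 ∎
    where open ≡-Reasoning

  transform-row : ∀ {x} → x ≢ v₁ → x ≢ v₂ → x ≢ uₘ → ∀ y → G* x y ≡ adj x y
  transform-row {x} x≢v₁ x≢v₂ x≢uₘ y =
    transform-unchanged x y (isPair-outside y x≢v₂ x≢v₁) (isPair-outside y x≢uₘ x≢v₂)

  deg-transform : ∀ {x} → x ≢ v₁ → x ≢ v₂ → x ≢ uₘ → deg G* x ≡ deg adj x
  deg-transform {x} x≢v₁ x≢v₂ x≢uₘ = begin
    deg G* x        ≡⟨ deg≡count G* x ⟩
    count (G* x)    ≡⟨ count-cong (transform-row x≢v₁ x≢v₂ x≢uₘ) ⟩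
    count (adj x)  ≡⟨ deg≡count adj x ⟨
    deg adj x      ∎
    where open ≡-Reasoning

  module Distinct (v₁≢v₂ : v₁ ≢ v₂) (v₁≢uₘ : v₁ ≢ uₘ) (v₂≢uₘ : v₂ ≢ uₘ) where

    transform-v₁v₂ : G* v₁ v₂ ≡ false
    transform-v₁v₂ = transform-removed v₁ v₂ (trans (isPair-comm v₂ v₁ v₁ v₂) (isPair-refl v₁ v₂))

    transform-v₂v₁ : G* v₂ v₁ ≡ false
    transform-v₂v₁ = transform-removed v₂ v₁ (isPair-refl v₂ v₁)

    transform-uₘv₂ : G* uₘ v₂ ≡ true
    transform-uₘv₂ = transform-added uₘ v₂ (isPair-outside v₂ (v₂≢uₘ ∘ sym) (v₁≢uₘ ∘ sym)) (isPair-refl uₘ v₂)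

    transform-v₂uₘ : G* v₂ uₘ ≡ true
    transform-v₂uₘ = transform-added v₂ uₘ (isPair-false (v₁≢uₘ ∘ sym ∘ proj₂) (v₁≢v₂ ∘ sym ∘ proj₁))
                                     (trans (isPair-comm uₘ v₂ v₂ uₘ) (isPair-refl v₂ uₘ))

    transform-row-v₁ : ∀ y → y ≢ v₂ → G* v₁ y ≡ adj v₁ y
    transform-row-v₁ y y≢v₂ = transform-unchanged v₁ y (isPair-false (v₁≢v₂ ∘ proj₁) (y≢v₂ ∘ proj₂))
                                                  (isPair-outside y v₁≢uₘ v₁≢v₂)

    transform-row-v₂ : ∀ y → y ≢ v₁ → y ≢ uₘ → G* v₂ y ≡ adj v₂ y
    transform-row-v₂ y y≢v₁ y≢uₘ = transform-unchanged v₂ y (isPair-false (y≢v₁ ∘ proj₂) (v₁≢v₂ ∘ sym ∘ proj₁))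
                                                      (isPair-false (v₂≢uₘ ∘ proj₁) (y≢uₘ ∘ proj₂))

    transform-row-uₘ : ∀ y → y ≢ v₂ → G* uₘ y ≡ adj uₘ y
    transform-row-uₘ y y≢v₂ = transform-unchanged uₘ y (isPair-outside y (v₂≢uₘ ∘ sym) (v₁≢uₘ ∘ sym))
                                                  (isPair-false (y≢v₂ ∘ proj₂) (v₂≢uₘ ∘ sym ∘ proj₁))

    deg-transform-v₁ : Edge adj v₁ v₂ → deg adj v₁ ≡ suc (deg G* v₁)
    deg-transform-v₁ v₁v₂ = trans (deg≡count adj v₁)
      (trans (count-insert v₂ transform-v₁v₂ v₁v₂ transform-row-v₁) (cong suc (sym (deg≡count G* v₁))))

    deg-transform-uₘ : adj uₘ v₂ ≡ false → deg G* uₘ ≡ suc (deg adj uₘ)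
    deg-transform-uₘ ¬uₘv₂ = trans (deg≡count G* uₘ)
      (trans (count-insert v₂ ¬uₘv₂ transform-uₘv₂ (λ y y≢v₂ → sym (transform-row-uₘ y y≢v₂)))
             (cong suc (sym (deg≡count adj uₘ))))

    -- Both rows arise from the row of v₂ with v₁ removed, by inserting v₁ or uₘ respectively.
    deg-transform-v₂ : Edge adj v₂ v₁ → adj v₂ uₘ ≡ false → deg G* v₂ ≡ deg adj v₂
    deg-transform-v₂ v₂v₁ ¬v₂uₘ = begin
      deg G* v₂                          ≡⟨ deg≡count G* v₂ ⟩
      count (G* v₂)                      ≡⟨ count-insert uₘ removed-uₘ transform-v₂uₘ same ⟩
      suc (count (remove (adj v₂) v₁))  ≡⟨ count-remove v₁ v₂v₁ ⟨
      count (adj v₂)                     ≡⟨ deg≡count adj v₂ ⟨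
      deg adj v₂                         ∎
      where
      open ≡-Reasoning
      removed-uₘ : remove (adj v₂) v₁ uₘ ≡ false
      removed-uₘ = trans (remove-other (adj v₂) (v₁≢uₘ ∘ sym)) ¬v₂uₘ
      same : ∀ y → y ≢ uₘ → remove (adj v₂) v₁ y ≡ G* v₂ y
      same y y≢uₘ = by-cases (y ≟ v₁)
        where
        by-cases : Dec (y ≡ v₁) → remove (adj v₂) v₁ y ≡ G* v₂ y
        by-cases (yes refl)  = trans (remove-at (adj v₂) v₁) (sym transform-v₂v₁)
        by-cases (no y≢v₁) = trans (remove-other (adj v₂) y≢v₁) (sym (transform-row-v₂ y y≢v₁ y≢uₘ))

-- Moving the pendant vertex

record PendantMove {N} (adj : Adj N) (u v₁ v₂ w uₘ : Fin N) : Set where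
  field
    uv₁    : Edge adj u v₁
    v₁v₂   : Edge adj v₁ v₂
    wuₘ    : Edge adj w uₘ
    deg-u  : 3 ≤ deg adj u
    deg-v₁ : deg adj v₁ ≡ 2
    deg-v₂ : deg adj v₂ ≡ 1
    deg-w  : deg adj w ≡ 2
    deg-uₘ : deg adj uₘ ≡ 1
    v₂≢uₘ  : v₂ ≢ uₘ
    w≢v₁   : w ≢ v₁
    w≢v₂   : w ≢ v₂

module Move {N} {adj : Adj N} (symmetric : ∀ x y → adj x y ≡ adj y x) {u v₁ v₂ w uₘ : Fin N}
            (P : PendantMove adj u v₁ v₂ w uₘ) where

  open PendantMove P

  G* : Adj N
  G* = transform adj v₁ v₂ uₘ

  d : ℕ
  d = deg adj u

  u≢v₁ : u ≢ v₁
  u≢v₁ = ≢-by-deg (subst (_< d) (sym deg-v₁) deg-u)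
  u≢v₂ : u ≢ v₂
  u≢v₂ = ≢-by-deg (subst (_< d) (sym deg-v₂) (≤-trans (n≤1+n 2) deg-u))
  u≢uₘ : u ≢ uₘ
  u≢uₘ = ≢-by-deg (subst (_< d) (sym deg-uₘ) (≤-trans (n≤1+n 2) deg-u))
  v₁≢v₂ : v₁ ≢ v₂
  v₁≢v₂ = ≢-by-deg (subst₂ _<_ (sym deg-v₂) (sym deg-v₁) ≤-refl)
  v₁≢uₘ : v₁ ≢ uₘ
  v₁≢uₘ = ≢-by-deg (subst₂ _<_ (sym deg-uₘ) (sym deg-v₁) ≤-refl)
  w≢uₘ : w ≢ uₘ
  w≢uₘ = ≢-by-deg (subst₂ _<_ (sym deg-uₘ) (sym deg-w) ≤-refl)

  open Transform adj v₁ v₂ uₘ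
  open Distinct v₁≢v₂ v₁≢uₘ v₂≢uₘ

  neighbour-of-v₁ : ∀ {y} → Edge adj v₁ y → y ≡ u ⊎ y ≡ v₂
  neighbour-of-v₁ = neighbour-of-deg₂ adj v₁ deg-v₁ (trans (symmetric v₁ u) uv₁) v₁v₂ u≢v₂
  neighbour-of-v₂ : ∀ {y} → Edge adj v₂ y → y ≡ v₁
  neighbour-of-v₂ = neighbour-of-deg₁ adj v₂ deg-v₂ (trans (symmetric v₂ v₁) v₁v₂)
  neighbour-of-uₘ : ∀ {y} → Edge adj uₘ y → y ≡ w
  neighbour-of-uₘ = neighbour-of-deg₁ adj uₘ deg-uₘ (trans (symmetric uₘ w) wuₘ)

  ¬uₘv₂ : adj uₘ v₂ ≡ false
  ¬uₘv₂ = ¬-not (w≢v₂ ∘ sym ∘ neighbour-of-uₘ)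
  ¬v₂uₘ : adj v₂ uₘ ≡ false
  ¬v₂uₘ = ¬-not (v₁≢uₘ ∘ sym ∘ neighbour-of-v₂)

  deg*-v₁ : deg G* v₁ ≡ 1
  deg*-v₁ = suc-injective (trans (sym (deg-transform-v₁ v₁v₂)) deg-v₁)
  deg*-v₂ : deg G* v₂ ≡ 1
  deg*-v₂ = trans (deg-transform-v₂ (trans (symmetric v₂ v₁) v₁v₂) ¬v₂uₘ) deg-v₂
  deg*-uₘ : deg G* uₘ ≡ 2
  deg*-uₘ = trans (deg-transform-uₘ ¬uₘv₂) (cong suc deg-uₘ)
  deg*-u : deg G* u ≡ d
  deg*-u = deg-transform u≢v₁ u≢v₂ u≢uₘ
  deg*-w : deg G* w ≡ 2
  deg*-w = trans (deg-transform w≢v₁ w≢v₂ w≢uₘ) deg-w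

  module Accounting (n K : ℕ) (1≤K : 1 ≤ K) (4ⁿ≡ : 4 ^ n ≡ (64 * K) * (64 * K)) where

    upper lower : ℕ → ℕ
    upper s = isqrt (s * 4 ^ n) + 1
    lower s = isqrt (s * 4 ^ n)

    old new surplus deficit : Fin N → Fin N → ℕ
    old = edgeTerm adj upper
    new = edgeTerm G* lower
    -- At scale 64K the gains lower 8 − upper 5 ≥ 37K on w uₘ and lower 5 ≥ 143K on uₘ v₂
    -- outweigh the losses upper (4 + d²) − lower (1 + d²) ≤ 32K + 1 on u v₁ and upper 5 ≤ 144K on v₁ v₂.
    surplus x y = when (isPair w uₘ x y) (37 * K) + when (isPair uₘ v₂ x y) (143 * K)
    deficit x y = 1 + when (isPair u v₁ x y) (32 * K + 1) + when (isPair v₁ v₂ x y) (144 * K)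

    Balanced : Fin N → Fin N → Set
    Balanced x y = old x y + surplus x y ≤ new x y + deficit x y

    private
      scaled : (P : ℕ → Set) → P ((64 * K) * (64 * K)) → P (4 ^ n)
      scaled P = subst P (sym 4ⁿ≡)

    upper-5 : upper 5 ≤ 144 * K
    upper-5 = scaled (λ X → isqrt (5 * X) + 1 ≤ 144 * K) (isqrt[5X]<144K K 1≤K)
    lower-5 : 143 * K ≤ lower 5
    lower-5 = scaled (λ X → 143 * K ≤ isqrt (5 * X)) (143K≤isqrt[5X] K)
    lower-8 : 181 * K ≤ lower 8
    lower-8 = scaled (λ X → 181 * K ≤ isqrt (8 * X)) (181K≤isqrt[8X] K)
    upper-lower-gap : upper (4 + d ^ 2) ≤ lower (1 + d ^ 2) + (32 * K + 1)
    upper-lower-gap = scaled (λ X → isqrt ((4 + d ^ 2) * X) + 1 ≤ isqrt ((1 + d ^ 2) * X) + (32 * K + 1))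
                             (isqrt-gap K d deg-u)

    balanced-from : ∀ {x y a s} → old x y ≡ a → surplus x y ≡ s → a + s ≤ new x y + deficit x y → Balanced x y
    balanced-from refl refl a+s≤ = a+s≤

    balanced-quiet : ∀ {x y} → old x y ≡ 0 → surplus x y ≡ 0 → Balanced x y
    balanced-quiet old≡0 surplus≡0 = balanced-from old≡0 surplus≡0 z≤n

    surplus-zero : ∀ x y → isPair w uₘ x y ≡ false → isPair uₘ v₂ x y ≡ false → surplus x y ≡ 0
    surplus-zero x y p q = cong₂ _+_ (when-false _ p) (when-false _ q)

    1≤deficit : ∀ x y → 1 ≤ deficit x y
    1≤deficit x y = ≤-trans (m≤m+n 1 (when (isPair u v₁ x y) (32 * K + 1))) (m≤m+n _ _)

    deficit-uv₁ : ∀ x y → isPair u v₁ x y ≡ true → 32 * K + 1 ≤ deficit x y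
    deficit-uv₁ x y p = ≤-trans (≤-reflexive (sym (when-true _ p))) (≤-trans (m≤n+m _ 1) (m≤m+n _ _))

    deficit-v₁v₂ : ∀ x y → isPair v₁ v₂ x y ≡ true → 144 * K ≤ deficit x y
    deficit-v₁v₂ x y p = ≤-trans (≤-reflexive (sym (when-true _ p))) (m≤n+m _ _)

    balanced-sym : ∀ {x y} → Balanced x y → Balanced y x
    balanced-sym {x} {y} = subst₂ _≤_ (cong₂ _+_ (edgeTerm-sym symmetric upper x y) surplus-sym)
                                      (cong₂ _+_ (edgeTerm-sym (transform-symmetric symmetric) lower x y) deficit-sym)
      where
      surplus-sym : surplus x y ≡ surplus y x
      surplus-sym = cong₂ (λ p q → when p (37 * K) + when q (143 * K))
                          (isPair-sym w uₘ x y) (isPair-sym uₘ v₂ x y)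
      deficit-sym : deficit x y ≡ deficit y x
      deficit-sym = cong₂ (λ p q → 1 + when p (32 * K + 1) + when q (144 * K))
                          (isPair-sym u v₁ x y) (isPair-sym v₁ v₂ x y)

    balanced-v₁ : ∀ y → Balanced v₁ y
    balanced-v₁ y = by-cases (y ≟ u) (y ≟ v₂)
      where
      surplus-v₁ : surplus v₁ y ≡ 0
      surplus-v₁ = surplus-zero v₁ y (isPair-outside y (w≢v₁ ∘ sym) v₁≢uₘ) (isPair-outside y v₁≢uₘ v₁≢v₂)
      by-cases : Dec (y ≡ u) → Dec (y ≡ v₂) → Balanced v₁ y
      by-cases (yes refl) _ = balanced-from old-v₁u surplus-v₁ (begin
        upper (4 + d ^ 2) + 0                 ≡⟨ +-identityʳ _ ⟩
        upper (4 + d ^ 2)                     ≤⟨ upper-lower-gap ⟩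
        lower (1 + d ^ 2) + (32 * K + 1)      ≤⟨ +-mono-≤ (≤-reflexive (sym new-v₁u)) (deficit-uv₁ v₁ u pair-uv₁) ⟩
        new v₁ u + deficit v₁ u               ∎)
        where
        open ≤-Reasoning
        v₁u : Edge adj v₁ u
        v₁u = trans (symmetric v₁ u) uv₁
        old-v₁u : old v₁ u ≡ upper (4 + d ^ 2)
        old-v₁u = edgeTerm-edge adj upper v₁ u v₁u deg-v₁ refl
        new-v₁u : new v₁ u ≡ lower (1 + d ^ 2)
        new-v₁u = edgeTerm-edge G* lower v₁ u (trans (transform-row-v₁ u u≢v₂) v₁u) deg*-v₁ deg*-u
        pair-uv₁ : isPair u v₁ v₁ u ≡ true
        pair-uv₁ = trans (isPair-comm u v₁ v₁ u) (isPair-refl v₁ u)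
      by-cases (no _) (yes refl) = balanced-from (edgeTerm-edge adj upper v₁ v₂ v₁v₂ deg-v₁ deg-v₂) surplus-v₁ (begin
        upper 5 + 0                           ≡⟨ +-identityʳ _ ⟩
        upper 5                               ≤⟨ upper-5 ⟩
        144 * K                               ≤⟨ deficit-v₁v₂ v₁ v₂ (isPair-refl v₁ v₂) ⟩
        deficit v₁ v₂                         ≤⟨ m≤n+m _ _ ⟩
        new v₁ v₂ + deficit v₁ v₂             ∎)
        where open ≤-Reasoning
      by-cases (no y≢u) (no y≢v₂) =
        balanced-quiet (edgeTerm-non adj upper v₁ y (¬-not (not-neighbour ∘ neighbour-of-v₁))) surplus-v₁
        where
        not-neighbour : ¬ (y ≡ u ⊎ y ≡ v₂)
        not-neighbour (inj₁ y≡u)  = y≢u y≡u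
        not-neighbour (inj₂ y≡v₂) = y≢v₂ y≡v₂

    balanced-v₂ : ∀ y → Balanced v₂ y
    balanced-v₂ y = by-cases (y ≟ v₁) (y ≟ uₘ)
      where
      by-cases : Dec (y ≡ v₁) → Dec (y ≡ uₘ) → Balanced v₂ y
      by-cases (yes refl) _ = balanced-sym (balanced-v₁ v₂)
      by-cases (no _) (yes refl) = balanced-from (edgeTerm-non adj upper v₂ uₘ ¬v₂uₘ) surplus-v₂uₘ (begin
        143 * K                               ≤⟨ lower-5 ⟩
        lower 5                               ≡⟨ new-v₂uₘ ⟨
        new v₂ uₘ                             ≤⟨ m≤m+n _ _ ⟩
        new v₂ uₘ + deficit v₂ uₘ             ∎)
        where
        open ≤-Reasoning
        surplus-v₂uₘ : surplus v₂ uₘ ≡ 0 + 143 * K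
        surplus-v₂uₘ = cong₂ _+_ (when-false _ (isPair-outside uₘ (w≢v₂ ∘ sym) v₂≢uₘ))
                                 (when-true _ (trans (isPair-comm uₘ v₂ v₂ uₘ) (isPair-refl v₂ uₘ)))
        new-v₂uₘ : new v₂ uₘ ≡ lower 5
        new-v₂uₘ = edgeTerm-edge G* lower v₂ uₘ transform-v₂uₘ deg*-v₂ deg*-uₘ
      by-cases (no y≢v₁) (no y≢uₘ) = balanced-quiet (edgeTerm-non adj upper v₂ y (¬-not (y≢v₁ ∘ neighbour-of-v₂)))
        (surplus-zero v₂ y (isPair-outside y (w≢v₂ ∘ sym) v₂≢uₘ) (isPair-false (v₂≢uₘ ∘ proj₁) (y≢uₘ ∘ proj₂)))

    balanced-uₘ : ∀ y → Balanced uₘ y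
    balanced-uₘ y = by-cases (y ≟ v₂) (y ≟ w)
      where
      by-cases : Dec (y ≡ v₂) → Dec (y ≡ w) → Balanced uₘ y
      by-cases (yes refl) _ = balanced-sym (balanced-v₂ uₘ)
      by-cases (no _) (yes refl) = balanced-from old-uₘw surplus-uₘw (begin
        upper 5 + 37 * K                      ≤⟨ +-monoˡ-≤ (37 * K) upper-5 ⟩
        144 * K + 37 * K                      ≡⟨ *-distribʳ-+ K 144 37 ⟨
        181 * K                               ≤⟨ lower-8 ⟩
        lower 8                               ≡⟨ new-uₘw ⟨
        new uₘ w                              ≤⟨ m≤m+n _ _ ⟩
        new uₘ w + deficit uₘ w               ∎)
        where
        open ≤-Reasoning
        old-uₘw : old uₘ w ≡ upper 5
        old-uₘw = edgeTerm-edge adj upper uₘ w (trans (symmetric uₘ w) wuₘ) deg-uₘ deg-w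
        surplus-uₘw : surplus uₘ w ≡ 37 * K
        surplus-uₘw = trans (cong₂ _+_ (when-true _ (trans (isPair-comm w uₘ uₘ w) (isPair-refl uₘ w)))
                                       (when-false _ (isPair-false (w≢v₂ ∘ proj₂) (v₂≢uₘ ∘ sym ∘ proj₁))))
                            (+-identityʳ _)
        new-uₘw : new uₘ w ≡ lower 8
        new-uₘw = edgeTerm-edge G* lower uₘ w (trans (transform-row-uₘ w w≢v₂)
                                                (trans (symmetric uₘ w) wuₘ)) deg*-uₘ deg*-w
      by-cases (no y≢v₂) (no y≢w) = balanced-quiet (edgeTerm-non adj upper uₘ y (¬-not (y≢w ∘ neighbour-of-uₘ)))
        (surplus-zero uₘ y (isPair-false (w≢uₘ ∘ sym ∘ proj₁) (y≢w ∘ proj₂))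
                           (isPair-false (y≢v₂ ∘ proj₂) (v₂≢uₘ ∘ sym ∘ proj₁)))

    balanced-outside : ∀ {x y} → x ∉ v₁ ∷ v₂ ∷ uₘ ∷ [] → y ∉ v₁ ∷ v₂ ∷ uₘ ∷ [] → Balanced x y
    balanced-outside {x} {y} x∉ y∉ = balanced-from refl surplus≡0 (begin
      when (adj x y) (upper s) + 0           ≡⟨ +-identityʳ _ ⟩
      when (adj x y) (lower s + 1)           ≤⟨ when-+-≤ (adj x y) ⟩
      when (adj x y) (lower s) + 1           ≡⟨ cong (_+ 1) new≡ ⟨
      new x y + 1                            ≤⟨ +-monoʳ-≤ (new x y) (1≤deficit x y) ⟩
      new x y + deficit x y                  ∎)
      where
      open ≤-Reasoning
      s : ℕ
      s = deg adj x ^ 2 + deg adj y ^ 2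
      when-+-≤ : ∀ b → when b (lower s + 1) ≤ when b (lower s) + 1
      when-+-≤ true  = ≤-refl
      when-+-≤ false = z≤n
      x≢v₁ : x ≢ v₁
      x≢v₁ = x∉ ∘ here
      x≢v₂ : x ≢ v₂
      x≢v₂ = x∉ ∘ there ∘ here
      x≢uₘ : x ≢ uₘ
      x≢uₘ = x∉ ∘ there ∘ there ∘ here
      y≢v₁ : y ≢ v₁
      y≢v₁ = y∉ ∘ here
      y≢v₂ : y ≢ v₂
      y≢v₂ = y∉ ∘ there ∘ here
      y≢uₘ : y ≢ uₘ
      y≢uₘ = y∉ ∘ there ∘ there ∘ here
      new≡ : new x y ≡ when (adj x y) (lower s)
      new≡ = cong₂ (λ b s → when b (lower s)) (transform-row x≢v₁ x≢v₂ x≢uₘ y)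
                   (cong₂ (λ p q → p ^ 2 + q ^ 2) (deg-transform x≢v₁ x≢v₂ x≢uₘ) (deg-transform y≢v₁ y≢v₂ y≢uₘ))
      surplus≡0 : surplus x y ≡ 0
      surplus≡0 = surplus-zero x y (isPair-false (y≢uₘ ∘ proj₂) (x≢uₘ ∘ proj₁)) (isPair-outside y x≢uₘ x≢v₂)

    balanced : ∀ x y → Balanced x y
    balanced = by-symmetry balanced-sym (v₁ ∷ v₂ ∷ uₘ ∷ []) special balanced-outside
      where
      special : ∀ {x} → x ∈ v₁ ∷ v₂ ∷ uₘ ∷ [] → ∀ y → Balanced x y
      special (here refl)                 = balanced-v₁
      special (there (here refl))         = balanced-v₂
      special (there (there (here refl))) = balanced-uₘ

    totals : ∑< old + (37 * K + 143 * K) ≤ ∑< new + (∑< {N} (λ _ _ → 1) + (32 * K + 1) + 144 * K)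
    totals = subst₂ _≤_ (trans (∑<-+ old surplus) (cong (∑< old +_) surplus-total))
                        (trans (∑<-+ new deficit) (cong (∑< new +_) deficit-total))
                        (∑<-mono-≤ balanced)
      where
      surplus-total : ∑< surplus ≡ 37 * K + 143 * K
      surplus-total = trans (∑<-+ (λ x y → when (isPair w uₘ x y) (37 * K)) _)
                            (cong₂ _+_ (∑<-pair w uₘ _ w≢uₘ) (∑<-pair uₘ v₂ _ (v₂≢uₘ ∘ sym)))
      deficit-total : ∑< deficit ≡ ∑< {N} (λ _ _ → 1) + (32 * K + 1) + 144 * K
      deficit-total = trans (∑<-+ (λ x y → 1 + when (isPair u v₁ x y) (32 * K + 1)) _)
        (cong₂ _+_ (trans (∑<-+ {N} (λ _ _ → 1) _) (cong (∑< {N} (λ _ _ → 1) +_) (∑<-pair u v₁ _ u≢v₁)))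
                   (∑<-pair v₁ v₂ _ v₁≢v₂))

SO-increases : ∀ {N} {adj : Adj N} {u v₁ v₂ w uₘ} → (∀ x y → adj x y ≡ adj y x) →
               PendantMove adj u v₁ v₂ w uₘ → SOLt adj (transform adj v₁ v₂ uₘ)
SO-increases {N} {adj} symmetric P =
  6 + t , subst₂ _<_ (sym (sum-soTerms adj upper)) (sym (sum-soTerms G* lower))
                    (absorb-budget (≤-<-trans (∑<-1 N) (n<2^n t)) totals)
  where
  t : ℕ
  t = N * N
  open Move symmetric P
  open Accounting (6 + t) (2 ^ t) (m^n>0 2 t) (4^[6+n]≡[64·2^n]² t)

pendant-move : ∀ {N} {adj : Adj N} {c u v₁ v₂ a uₘ} as → (∀ x y → adj x y ≡ adj y x) → IsCycle adj c → u ∈ c →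
               PendantPath adj c u (v₁ ∷ v₂ ∷ []) → PendantPath adj c u (a ∷ as ∷ʳ uₘ) →
               v₁ ∷ v₂ ∷ [] ≢ a ∷ as ∷ʳ uₘ → ∃ λ w → PendantMove adj u v₁ v₂ w uₘ
pendant-move {adj = adj} {u = u} {v₁} {v₂} {a} {uₘ} as symmetric cycle u∈c
  (uv₁ ∷ v₁v₂ ∷ [-] , (u≢v₁ ∷ u≢v₂ ∷ []) ∷ _ , midV v₁∉c deg-v₁ (lastV _ deg-v₂))
  Pₘ@(linked@(ua ∷ _) , _ , tail) P₂≢Pₘ
  with penultimate a as linked tail | cycle-neighbour cycle u∈c
... | w , w∈ , wuₘ , deg-w | z , z∈c , uz = w , record
  { uv₁ = uv₁ ; v₁v₂ = v₁v₂ ; wuₘ = wuₘ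
  ; deg-u = three-neighbours≤deg adj u uv₁ ua uz (proj₁ (off (here refl)) ∘ sym) (λ { refl → v₁∉c z∈c })
                                 (λ { refl → pendantTail-head tail z∈c })
  ; deg-v₁ = deg-v₁ ; deg-v₂ = deg-v₂ ; deg-w = deg-w ; deg-uₘ = pendantTail-last (a ∷ as) tail
  ; v₂≢uₘ = proj₂ (off (∈-++⁺ʳ (a ∷ as) (here refl))) ∘ sym
  ; w≢v₁ = proj₁ (off (∈-++⁺ˡ w∈)) ; w≢v₂ = proj₂ (off (∈-++⁺ˡ w∈))
  }
  where
  off : ∀ {x} → x ∈ a ∷ as ∷ʳ uₘ → x ≢ v₁ × x ≢ v₂
  off {x} x∈ = ¬near ∘ inj₁ , ¬near ∘ inj₂
    where
    ¬near : ¬ (x ≡ v₁ ⊎ x ≡ v₂)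
    ¬near = All.lookup (pendant-path-avoids symmetric uv₁ v₁v₂ u≢v₁ u≢v₂ deg-v₁ deg-v₂ Pₘ P₂≢Pₘ) x∈

lemma3p2 : ∀ {N k : ℕ} (adj : Adj N) → IsSimple adj →
    (c : List (Fin N)) → Unicyclic adj c → pendantCount adj ≡ k →
    (u v1 v2 : Fin N) (us : List (Fin N)) (um : Fin N) (m : ℕ) →
    u ∈ c →
    PendantPath adj c u (v1 ∷ v2 ∷ []) →
    PendantPath adj c u (us ∷ʳ um) → length (us ∷ʳ um) ≡ m → 2 ≤ m →
    (v1 ∷ v2 ∷ []) ≢ (us ∷ʳ um) →
    SOLt adj (transform adj v1 v2 um)
lemma3p2 _ _ _ _ _ _ _ _ [] _ _ _ _ _ refl 2≤1 _ = contradiction 2≤1 (<-irrefl refl)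
lemma3p2 adj (symmetric , _) c (_ , cycle , _) _ u v1 v2 (a ∷ as) um m u∈c P₂ Pₘ _ _ P₂≢Pₘ =
  SO-increases symmetric (proj₂ (pendant-move as symmetric cycle u∈c P₂ Pₘ P₂≢Pₘ))
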